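{- For all integers $n\ge 6$ and $k\le n$, $S(C_{n-3}\cup C_3,k)=S(Q_n,k)-(-1)^n\rho_k$, where $\rho_k=2$ if $k=3$, $\rho_k=1$ if $k=4$, and $\rho_k=0$ otherwise.
   Context: For a finite simple graph $H$ and an integer $k$, $S(H,k)$ denotes the number of partitions of $V(H)$ into exactly $k$ nonempty stable sets. $C_m$ is the cycle on $m$ vertices, $\cup$ denotes disjoint union, $P_n$ is the path on $n$ vertices, and for $n\ge 3$, $Q_n$ is the graph obtained from $P_n$ by adding an edge between an endpoint $v$ of $P_n$ and the vertex at distance $2$ from $v$ on $P_n$. -}

module Defs where

open import Data.Nat using (ℕ; zero; suc; _+_; _∸_; _<_; _≟_; _<?_)
open import Data.Fin using (Fin; zero; suc; toℕ)
open import Data.Fin.Properties using (all?; any?)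
import Data.Fin.Properties as FinP
open import Data.Bool using (Bool; true; false; _∨_; _∧_)
open import Data.List using (List; []; _∷_; length; filter; concatMap; map; allFin)
open import Data.Product using (Σ; ∃; _×_; _,_)
open import Relation.Nullary using (Dec; yes; no; ¬_)
open import Relation.Nullary.Decidable using (⌊_⌋; _×-dec_; ¬?; _→-dec_)
open import Relation.Binary.PropositionalEquality using (_≡_)
open import Data.Bool.Properties using () renaming (_≟_ to _≟ᵇ_)
open import Data.Integer using (ℤ; +_; -[1+_])

-- A finite simple graph on vertex set Fin m, given by a Boolean adjacency
-- relation (all graphs built below are symmetric and loopless).
Graph : ℕ → Set
Graph m = Fin m → Fin m → Bool

undirected : (m : ℕ) → (ℕ → ℕ → Bool) → Graph m
undirected m E i j = E (toℕ i) (toℕ j) ∨ E (toℕ j) (toℕ i)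

-- A partition of Fin m into exactly k nonempty stable sets is encoded by
-- its canonical labelling f : Fin m → Fin k (block c = f⁻¹(c)), with
-- the blocks numbered in order of their least element:
--   * every label is used (exactly k nonempty blocks),
--   * labels appear in order of first occurrence: if c < f i then label c
--     already occurs at some vertex j < i,
--   * each block is stable: adjacent vertices get different labels.
-- This gives a bijection with unordered partitions into k nonempty stable sets.
Surjective : ∀ {m k} → (Fin m → Fin k) → Set
Surjective {m} {k} f = (c : Fin k) → ∃ λ i → f i ≡ c

FirstOccOrdered : ∀ {m k} → (Fin m → Fin k) → Set
FirstOccOrdered {m} {k} f =
  (i : Fin m) (c : Fin k) → toℕ c < toℕ (f i) → ∃ λ j → (toℕ j < toℕ i) × (f j ≡ c)

Stable : ∀ {m k} → Graph m → (Fin m → Fin k) → Set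
Stable {m} G f = (i j : Fin m) → G i j ≡ true → ¬ (f i ≡ f j)

IsStablePartition : ∀ {m k} → Graph m → (Fin m → Fin k) → Set
IsStablePartition G f = Surjective f × FirstOccOrdered f × Stable G f

isStablePartition? : ∀ {m k} (G : Graph m) (f : Fin _ → Fin k) → Dec (IsStablePartition {m} {k} G f)
isStablePartition? G f =
  all? (λ c → any? (λ i → f i FinP.≟ c))
  ×-dec all? (λ i → all? (λ c → (toℕ c <? toℕ (f i)) →-dec
                                any? (λ j → (toℕ j <? toℕ i) ×-dec (f j FinP.≟ c))))
  ×-dec all? (λ i → all? (λ j → (G i j ≟ᵇ true) →-dec ¬? (f i FinP.≟ f j)))

allFuns : (m k : ℕ) → List (Fin m → Fin k)
allFuns zero    k = (λ ()) ∷ []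
allFuns (suc m) k =
  concatMap (λ c → map (λ g → λ { zero → c ; (suc i) → g i }) (allFuns m k)) (allFin k)

S : ∀ {m} → Graph m → ℕ → ℕ
S {m} G k = length (filter (isStablePartition? {m} {k} G) (allFuns m k))

-- C_{n-3} ∪ C_3 on Fin n (n ≥ 6): vertices 0..n-4 form the cycle C_{n-3},
-- vertices n-3, n-2, n-1 form the triangle C_3.
cycleUnionTriangleE : ℕ → ℕ → ℕ → Bool
cycleUnionTriangleE n a b =
     (⌊ b ≟ suc a ⌋ ∧ ⌊ b <? n ∸ 3 ⌋)
  ∨ (⌊ a ≟ 0 ⌋ ∧ ⌊ b ≟ n ∸ 4 ⌋)
  ∨ (⌊ a ≟ n ∸ 3 ⌋ ∧ ⌊ b ≟ n ∸ 2 ⌋)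
  ∨ (⌊ a ≟ n ∸ 2 ⌋ ∧ ⌊ b ≟ n ∸ 1 ⌋)
  ∨ (⌊ a ≟ n ∸ 3 ⌋ ∧ ⌊ b ≟ n ∸ 1 ⌋)

CycleUnionTriangle : (n : ℕ) → Graph n
CycleUnionTriangle n = undirected n (cycleUnionTriangleE n)

-- Q_n on Fin n (n ≥ 3): the path 0 - 1 - ... - (n-1) plus the edge {0,2}.
QE : ℕ → ℕ → ℕ → Bool
QE n a b = (⌊ b ≟ suc a ⌋ ∧ ⌊ b <? n ⌋) ∨ (⌊ a ≟ 0 ⌋ ∧ ⌊ b ≟ 2 ⌋)

Q : (n : ℕ) → Graph n
Q n = undirected n (QE n)

ρ : ℕ → ℤ
ρ 3 = + 2
ρ 4 = + 1
ρ _ = + 0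

-- A partition into k stable sets is a canonical labelling: the vertices 0, 1, 2, … are labelled
-- in order, each by a label already in use or by the next new one, until all k labels are used.
-- If u labels are in use and the next vertex has earlier neighbours carrying j distinct labels,
-- the number of ways to finish is A_j N u = (u − j)·N(u) + [u < k]·N(u + 1), where N counts the
-- ways to finish the remaining vertices.  Let k ≥ 2 (for k ≤ 1 both counts vanish).  In Q_n the
-- first three labels are forced and a path remains, giving [2 < k]·A₁ⁿ⁻³δ(3) with δ(u) = [k ≤ u].
-- In C_{n−3} ∪ C_3 the first two labels are forced, the rest of the cycle is a two-state
-- recurrence (is the previous label 0?) ending in a triangle, and solving it gives
-- A₁ⁿ⁻⁴w(2) − (−1)ⁿw(2) with w = A₁A₂δ.  Finally A₁(A₁g − g)(2) = [2 < k]·A₁g(3) turns the first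
-- term into the count for Q_n, and w(2) = ρ_k.
module Submission where

open import Data.Bool using (Bool; true; false; _∧_; _∨_; not; if_then_else_; T)
open import Data.Bool.Properties
  using (T-≡; T-not-≡; T-∧; ∨-comm; ∨-idem; ∨-identityʳ; ∧-identityʳ; ∧-zeroʳ)
open import Data.Empty using (⊥-elim)
open import Data.Fin using (Fin; zero; suc; toℕ; fromℕ<)
open import Data.Fin.Properties
  using (toℕ-injective; toℕ<n; toℕ-fromℕ<) renaming (_≟_ to _≟ᶠ_)
open import Data.Integer using (ℤ; +_; -[1+_]; 0ℤ; 1ℤ; _+_; _-_; _*_; _^_)
import Data.Integer.Properties as ℤₚ
open import Data.Integer.Tactic.RingSolver using (solve-∀)
open import Data.List using (List; []; _∷_; length; filter; concatMap; map; _++_; tabulate)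
open import Data.List.Properties using (filter-++; length-++)
open import Data.Nat as ℕ
  using (ℕ; zero; suc; _<_; _≤_; _⊔_; z≤n; s≤s; z<s; s<s; _<ᵇ_; _≤ᵇ_; _≡ᵇ_)
open import Data.Nat.Properties
open import Data.Product using (∃; _×_; _,_; proj₁; proj₂)
open import Data.Sum using (_⊎_; inj₁; inj₂)
open import Function using (_∘_; _⇔_; mk⇔; Equivalence)
open import Level using (0ℓ)
open import Relation.Nullary using (yes; no; ¬_; contradiction)
open import Relation.Nullary.Decidable using (isYes≗does)
open import Relation.Unary using (Pred; Decidable; _≐_)
open import Relation.Binary.PropositionalEquality

open import Defs

≢⇒≡ᵇ-false : ∀ {m n} → m ≢ n → (m ≡ᵇ n) ≡ false
≢⇒≡ᵇ-false {m} {n} m≢n with m ≡ᵇ n in eq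
... | false = refl
... | true  = ⊥-elim (m≢n (≡ᵇ⇒≡ m n (Equivalence.from T-≡ eq)))

≡ᵇ-false⇒≢ : ∀ {m n} → (m ≡ᵇ n) ≡ false → m ≢ n
≡ᵇ-false⇒≢ {m} {n} eq m≡n with () ← trans (sym eq) (Equivalence.to T-≡ (≡⇒≡ᵇ m n m≡n))

>⇒≡ᵇ-false : ∀ {m n} → n < m → (m ≡ᵇ n) ≡ false
>⇒≡ᵇ-false = ≢⇒≡ᵇ-false ∘ >⇒≢

<⇒<ᵇ-true : ∀ {m n} → m < n → (m <ᵇ n) ≡ true
<⇒<ᵇ-true = Equivalence.to T-≡ ∘ <⇒<ᵇ

≡ᵇ-∧-≡ᵇ : ∀ {m n} → m ≢ n → ∀ a → (a ≡ᵇ m) ∧ (a ≡ᵇ n) ≡ false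
≡ᵇ-∧-≡ᵇ {m} m≢n a with a ≡ᵇ m in eq
... | false = refl
... | true rewrite ≡ᵇ⇒≡ a m (Equivalence.from T-≡ eq) = ≢⇒≡ᵇ-false m≢n

∨-∧-false⁻ : ∀ x y z → x ∨ (y ∧ z) ≡ false → x ≡ false × (y ≡ true → z ≡ false)
∨-∧-false⁻ false true  z eq = refl , λ _ → eq
∨-∧-false⁻ false false z eq = refl , λ ()

∨-∧-false⁺ : ∀ x y z → x ≡ false → (y ≡ true → z ≡ false) → x ∨ (y ∧ z) ≡ false
∨-∧-false⁺ x true  z refl z≡false = z≡false refl
∨-∧-false⁺ x false z refl _       = refl

if<ᵇ-cong : ∀ {A : Set} {m n} {x y z : A} → (m < n → x ≡ y) →
  (if m <ᵇ n then x else z) ≡ (if m <ᵇ n then y else z)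
if<ᵇ-cong {m = m} {n} x≡y with m <ᵇ n in eq
... | true  = x≡y (<ᵇ⇒< m n (Equivalence.from T-≡ eq))
... | false = refl

Σ< : ℕ → (ℕ → ℤ) → ℤ
Σ< zero    g = 0ℤ
Σ< (suc n) g = g 0 + Σ< n (g ∘ suc)

Σ<-cong : ∀ n {g h : ℕ → ℤ} → (∀ c → c < n → g c ≡ h c) → Σ< n g ≡ Σ< n h
Σ<-cong zero    eq = refl
Σ<-cong (suc n) eq = cong₂ _+_ (eq 0 z<s) (Σ<-cong n λ c c<n → eq (suc c) (s<s c<n))

Σ<-zero : ∀ n → Σ< n (λ _ → 0ℤ) ≡ 0ℤ
Σ<-zero zero    = refl
Σ<-zero (suc n) = trans (ℤₚ.+-identityˡ _) (Σ<-zero n)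

Σ<-split : ∀ n u (φ : ℕ → Bool) (g : ℕ → ℤ) → u ≤ n →
  Σ< n (λ c → if (c <ᵇ suc u) ∧ φ c then g c else 0ℤ) ≡
  Σ< u (λ c → if φ c then g c else 0ℤ) + (if (u <ᵇ n) ∧ φ u then g u else 0ℤ)
Σ<-split zero    zero    φ g z≤n       = refl
Σ<-split (suc n) zero    φ g z≤n       =
  trans (cong (_+_ g₀) (Σ<-zero n)) (ℤₚ.+-comm g₀ 0ℤ)
  where g₀ : ℤ
        g₀ = if φ 0 then g 0 else 0ℤ
Σ<-split (suc n) (suc u) φ g (s≤s u≤n) =
  trans (cong (_+_ g₀) (Σ<-split n u (φ ∘ suc) (g ∘ suc) u≤n)) (sym (ℤₚ.+-assoc g₀ _ _))
  where g₀ : ℤ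
        g₀ = if φ 0 then g 0 else 0ℤ

countBelow : ℕ → (ℕ → Bool) → ℕ
countBelow zero    φ = 0
countBelow (suc u) φ = if φ 0 then suc (countBelow u (φ ∘ suc)) else countBelow u (φ ∘ suc)

countBelow-cong : ∀ u {φ ψ} → (∀ d → φ d ≡ ψ d) → countBelow u φ ≡ countBelow u ψ
countBelow-cong zero    eq = refl
countBelow-cong (suc u) {φ} {ψ} eq rewrite eq 0 =
  cong (λ n → if ψ 0 then suc n else n) (countBelow-cong u (eq ∘ suc))

countBelow-none : ∀ u → countBelow u (λ _ → false) ≡ 0
countBelow-none zero    = refl
countBelow-none (suc u) = countBelow-none u

countBelow-snoc : ∀ u φ → φ u ≡ false → countBelow (suc u) φ ≡ countBelow u φ
countBelow-snoc zero    φ φ0 rewrite φ0 = refl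
countBelow-snoc (suc u) φ φu =
  cong (λ n → if φ 0 then suc n else n) (countBelow-snoc u (φ ∘ suc) φu)

countBelow-insert : ∀ {u c} φ → c < u → φ c ≡ false →
  countBelow u (λ d → φ d ∨ (d ≡ᵇ c)) ≡ suc (countBelow u φ)
countBelow-insert {suc u} {zero} φ _ φ0 rewrite φ0 =
  cong suc (countBelow-cong u λ d → ∨-identityʳ (φ (suc d)))
countBelow-insert {suc u} {suc c} φ (s<s c<u) φc with φ 0
... | true  = cong suc (countBelow-insert (φ ∘ suc) c<u φc)
... | false = countBelow-insert (φ ∘ suc) c<u φc

countBelow-single : ∀ {u c} → c < u → countBelow u (_≡ᵇ c) ≡ 1
countBelow-single {u} c<u =
  trans (countBelow-insert (λ _ → false) c<u refl) (cong suc (countBelow-none u))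

countBelow-zero-or : ∀ {u} l → l < u →
  countBelow u (λ d → (d ≡ᵇ 0) ∨ (d ≡ᵇ l)) ≡ (if l ≡ᵇ 0 then 1 else 2)
countBelow-zero-or {u} zero    0<u =
  trans (countBelow-cong u λ d → ∨-idem (d ≡ᵇ 0)) (countBelow-single 0<u)
countBelow-zero-or     (suc l) l<u =
  trans (countBelow-insert (_≡ᵇ 0) l<u refl) (cong suc (countBelow-single (≤-<-trans z≤n l<u)))

Σ<-avoiding : ∀ u (φ : ℕ → Bool) x →
  Σ< u (λ d → if φ d then 0ℤ else x) ≡ (+ u - + countBelow u φ) * x
Σ<-avoiding zero    φ x = refl
Σ<-avoiding (suc u) φ x with φ 0
... | true  = trans (cong (_+_ 0ℤ) (Σ<-avoiding u (φ ∘ suc) x))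
                    (shift₁ (+ u) (+ countBelow u (φ ∘ suc)) x)
  where shift₁ : ∀ a b x → 0ℤ + (a - b) * x ≡ ((1ℤ + a) - (1ℤ + b)) * x
        shift₁ = solve-∀
... | false = trans (cong (_+_ x) (Σ<-avoiding u (φ ∘ suc) x))
                    (shift₀ (+ u) (+ countBelow u (φ ∘ suc)) x)
  where shift₀ : ∀ a b x → x + (a - b) * x ≡ ((1ℤ + a) - b) * x
        shift₀ = solve-∀

Σ<-except : ∀ {u l} → l < u → (g : Bool → ℤ) →
  Σ< u (λ d → if d ≡ᵇ l then 0ℤ else g (d ≡ᵇ 0)) ≡
  (if l ≡ᵇ 0 then (+ u - 1ℤ) * g false else g true + (+ u - + 2) * g false)
Σ<-except {suc u} {zero}  _         g =
  trans (cong (_+_ 0ℤ) (trans (Σ<-avoiding u (λ _ → false) (g false))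
                              (cong (λ j → (+ u - + j) * g false) (countBelow-none u))))
        (shift₁ (+ u) (g false))
  where shift₁ : ∀ a y → 0ℤ + (a - + 0) * y ≡ ((1ℤ + a) - 1ℤ) * y
        shift₁ = solve-∀
Σ<-except {suc u} {suc l} (s<s l<u) g =
  trans (cong (_+_ (g true)) (trans (Σ<-avoiding u (_≡ᵇ l) (g false))
                                    (cong (λ j → (+ u - + j) * g false) (countBelow-single l<u))))
        (shift₁ (g true) (+ u) (g false))
  where shift₁ : ∀ x a y → x + (a - 1ℤ) * y ≡ x + ((1ℤ + a) - (1ℤ + 1ℤ)) * y
        shift₁ = solve-∀

module _ {A : Set} {p} {P : Pred A p} (P? : Decidable P) where

  length-filter-map : {B : Set} (g : B → A) (xs : List B) →
    length (filter P? (map g xs)) ≡ length (filter (P? ∘ g) xs)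
  length-filter-map g []       = refl
  length-filter-map g (x ∷ xs) with P? (g x)
  ... | yes _ = cong suc (length-filter-map g xs)
  ... | no  _ = length-filter-map g xs

  length-filter-none : (∀ x → ¬ P x) → (xs : List A) → length (filter P? xs) ≡ 0
  length-filter-none ¬P []       = refl
  length-filter-none ¬P (x ∷ xs) with P? x
  ... | yes p = ⊥-elim (¬P x p)
  ... | no  _ = length-filter-none ¬P xs

  length-filter-concatMap-tabulate :
    {B : Set} {n : ℕ} (g : Fin n → B) (h : B → List A) (H : ℕ → ℤ) →
    (∀ i → + length (filter P? (h (g i))) ≡ H (toℕ i)) →
    + length (filter P? (concatMap h (tabulate g))) ≡ Σ< n H
  length-filter-concatMap-tabulate {n = zero}  g h H eq = refl
  length-filter-concatMap-tabulate {n = suc n} g h H eq = begin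
    + length (filter P? (h (g zero) ++ rest))
      ≡⟨ cong (+_ ∘ length) (filter-++ P? (h (g zero)) rest) ⟩
    + length (filter P? (h (g zero)) ++ filter P? rest)
      ≡⟨ cong +_ (length-++ (filter P? (h (g zero)))) ⟩
    + (length (filter P? (h (g zero))) ℕ.+ length (filter P? rest))
      ≡⟨ ℤₚ.pos-+ (length (filter P? (h (g zero)))) _ ⟩
    + length (filter P? (h (g zero))) + + length (filter P? rest)
      ≡⟨ cong₂ _+_ (eq zero) (length-filter-concatMap-tabulate (g ∘ suc) h (H ∘ suc) (eq ∘ suc)) ⟩
    H 0 + Σ< n (H ∘ suc) ∎
    where
    open ≡-Reasoning
    rest : List A
    rest = concatMap h (tabulate (g ∘ suc))

Table : Set
Table = ℕ → ℕ → Bool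

adjacent : Table → ℕ → ℕ → Bool
adjacent E a b = E a b ∨ E b a

Loopless : ℕ → Table → Set
Loopless m E = ∀ a → a < m → E a a ≡ false

IsClique : ℕ → Table → Set
IsClique s E = ∀ a b → a < b → b < s → adjacent E a b ≡ true

-- The state after labelling some vertices: the unlabelled vertices are renumbered 0, 1, …, E
-- holds the edges among them, and F a d says that vertex a has a labelled neighbour with label d.
shift : Table → Table
shift E a b = E (suc a) (suc b)

shiftForbidden : (E F : Table) → ℕ → Table
shiftForbidden E F c a d = F (suc a) d ∨ (adjacent E 0 (suc a) ∧ (d ≡ᵇ c))

nothingForbidden : Table
nothingForbidden _ _ = false

path : ℕ → Table
path s a b = (b ≡ᵇ suc a) ∧ (b <ᵇ s)

path-loopless : ∀ s a → path s a a ≡ false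
path-loopless s a rewrite ≢⇒≡ᵇ-false (<⇒≢ (n<1+n a)) = refl

firstForbids : ℕ → Table
firstForbids l a d = (a ≡ᵇ 0) ∧ (d ≡ᵇ l)

triangleAt : ℕ → Table
triangleAt o a b = ((a ≡ᵇ o) ∧ (b ≡ᵇ suc o))
                 ∨ ((a ≡ᵇ suc o) ∧ (b ≡ᵇ suc (suc o)))
                 ∨ ((a ≡ᵇ o) ∧ (b ≡ᵇ suc (suc o)))

triangleAt-loopless : ∀ o a → triangleAt o a a ≡ false
triangleAt-loopless o a
  rewrite ≡ᵇ-∧-≡ᵇ (<⇒≢ (n<1+n o)) a | ≡ᵇ-∧-≡ᵇ (<⇒≢ (n<1+n (suc o))) a
        | ≡ᵇ-∧-≡ᵇ (<⇒≢ (m≤n⇒m≤1+n (n<1+n o))) a = refl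

triangleAt-below : ∀ {o b} a → b ≤ o → triangleAt o a b ≡ false
triangleAt-below {o} {b} a b≤o
  rewrite ≢⇒≡ᵇ-false (<⇒≢ (s≤s b≤o)) | ≢⇒≡ᵇ-false (<⇒≢ (s≤s (m≤n⇒m≤1+n b≤o)))
        | ∧-zeroʳ (a ≡ᵇ o) | ∧-zeroʳ (a ≡ᵇ suc o) = refl

pathThenTriangle : ℕ → Table
pathThenTriangle r a b = path (suc r) a b ∨ triangleAt (suc r) a b

pathThenTriangle-adjacent₀ : ∀ r a → adjacent (pathThenTriangle (suc r)) 0 (suc a) ≡ (a ≡ᵇ 0)
pathThenTriangle-adjacent₀ r zero    = refl
pathThenTriangle-adjacent₀ r (suc a) = cong (false ∨_) (triangleAt-below {suc (suc r)} (suc (suc a)) z≤n)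

-- What remains of C_{n−3} ∪ C_3 after labelling cycle vertices: vertex 0 follows a vertex
-- labelled l, and vertex r closes the cycle at the vertex labelled 0.
cycleForbidden : ℕ → ℕ → Table
cycleForbidden r l a d = ((a ≡ᵇ r) ∧ (d ≡ᵇ 0)) ∨ ((a ≡ᵇ 0) ∧ (d ≡ᵇ l))

shiftForbidden-cycleForbidden : ∀ {r l E F} → (∀ a b → E a b ≡ pathThenTriangle (suc r) a b) →
  (∀ a d → F a d ≡ cycleForbidden (suc r) l a d) →
  ∀ d a e → shiftForbidden E F d a e ≡ cycleForbidden r d a e
shiftForbidden-cycleForbidden {r} edges forbids d a e =
  trans (cong₂ (λ x y → x ∨ (y ∧ (e ≡ᵇ d)))
               (forbids (suc a) e)
               (trans (cong₂ _∨_ (edges 0 (suc a)) (edges (suc a) 0)) (pathThenTriangle-adjacent₀ r a)))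
        (cong (_∨ ((a ≡ᵇ 0) ∧ (e ≡ᵇ d))) (∨-identityʳ _))

shift-pathThenTriangle-isClique : ∀ {E} → (∀ a b → E a b ≡ pathThenTriangle 0 a b) →
  IsClique 3 (shift E)
shift-pathThenTriangle-isClique edges 0 1 _ _ rewrite edges 1 2 = refl
shift-pathThenTriangle-isClique edges 0 2 _ _ rewrite edges 1 3 = refl
shift-pathThenTriangle-isClique edges 1 2 _ _ rewrite edges 2 3 = refl
shift-pathThenTriangle-isClique _ _             0                   ()             _
shift-pathThenTriangle-isClique _ (suc _)       1                   (s≤s ())       _
shift-pathThenTriangle-isClique _ (suc (suc _)) 2                   (s≤s (s≤s ())) _
shift-pathThenTriangle-isClique _ _             (suc (suc (suc _))) _              (s≤s (s≤s (s≤s ())))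

shiftForbidden-cycleForbidden₀ : ∀ {l E F} → (∀ a b → E a b ≡ pathThenTriangle 0 a b) →
  (∀ a d → F a d ≡ cycleForbidden 0 l a d) → ∀ d a e → a < 3 → shiftForbidden E F d a e ≡ false
shiftForbidden-cycleForbidden₀ edges forbids d 0 e _ rewrite forbids 1 e | edges 0 1 | edges 1 0 = refl
shiftForbidden-cycleForbidden₀ edges forbids d 1 e _ rewrite forbids 2 e | edges 0 2 | edges 2 0 = refl
shiftForbidden-cycleForbidden₀ edges forbids d 2 e _ rewrite forbids 3 e | edges 0 3 | edges 3 0 = refl
shiftForbidden-cycleForbidden₀ _ _ d (suc (suc (suc _))) e (s≤s (s≤s (s≤s ())))

cycleUnionTriangle-tables : ∀ r a b → cycleUnionTriangleE (6 ℕ.+ r) a b ≡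
  path (3 ℕ.+ r) a b ∨ ((a ≡ᵇ 0) ∧ (b ≡ᵇ 2 ℕ.+ r)) ∨ triangleAt (3 ℕ.+ r) a b
cycleUnionTriangle-tables r a b
  rewrite isYes≗does (b ≟ suc a) | isYes≗does (b ℕ.<? 3 ℕ.+ r)
        | isYes≗does (a ≟ 0) | isYes≗does (b ≟ 2 ℕ.+ r)
        | isYes≗does (a ≟ 3 ℕ.+ r) | isYes≗does (b ≟ 4 ℕ.+ r)
        | isYes≗does (a ≟ 4 ℕ.+ r) | isYes≗does (b ≟ 5 ℕ.+ r) = refl

cycleUnionTriangle-loopless : ∀ r a → cycleUnionTriangleE (6 ℕ.+ r) a a ≡ false
cycleUnionTriangle-loopless r a =
  trans (cycleUnionTriangle-tables r a a)
        (cong₂ _∨_ (path-loopless (3 ℕ.+ r) a)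
                   (cong₂ _∨_ (≡ᵇ-∧-≡ᵇ (λ ()) a) (triangleAt-loopless (3 ℕ.+ r) a)))

cycleUnionTriangle-adjacent₀ : ∀ r a →
  adjacent (cycleUnionTriangleE (6 ℕ.+ r)) 0 (2 ℕ.+ a) ≡ (a ≡ᵇ r)
cycleUnionTriangle-adjacent₀ r a =
  trans (cong₂ _∨_ (cycleUnionTriangle-tables r 0 (2 ℕ.+ a))
                   (trans (cycleUnionTriangle-tables r (2 ℕ.+ a) 0)
                          (triangleAt-below {3 ℕ.+ r} (2 ℕ.+ a) z≤n)))
        (trans (∨-identityʳ ((a ≡ᵇ r) ∨ false)) (∨-identityʳ (a ≡ᵇ r)))

cycleUnionTriangle-adjacent₁ : ∀ r a →
  adjacent (cycleUnionTriangleE (6 ℕ.+ r)) 1 (2 ℕ.+ a) ≡ (a ≡ᵇ 0)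
cycleUnionTriangle-adjacent₁ r zero    = refl
cycleUnionTriangle-adjacent₁ r (suc a) =
  cong (false ∨_) (trans (cycleUnionTriangle-tables r (3 ℕ.+ a) 1)
                         (triangleAt-below {3 ℕ.+ r} (3 ℕ.+ a) (s≤s z≤n)))

Q-tables : ∀ r a b → QE (6 ℕ.+ r) a b ≡ path (6 ℕ.+ r) a b ∨ ((a ≡ᵇ 0) ∧ (b ≡ᵇ 2))
Q-tables r a b
  rewrite isYes≗does (b ≟ suc a) | isYes≗does (b ℕ.<? 6 ℕ.+ r)
        | isYes≗does (a ≟ 0) | isYes≗does (b ≟ 2) = refl

Q-loopless : ∀ r a → QE (6 ℕ.+ r) a a ≡ false
Q-loopless r a =
  trans (Q-tables r a a) (cong₂ _∨_ (path-loopless (6 ℕ.+ r) a) (≡ᵇ-∧-≡ᵇ (λ ()) a))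

-- Counting canonical labellings with k labels

module Counting (k : ℕ) where

  admissible : ℕ → Table → ℕ → Bool
  admissible u F c = (c <ᵇ suc u) ∧ not (F 0 c)

  module _ {m : ℕ} where

    UsesLabelsFrom : ℕ → (Fin m → Fin k) → Set
    UsesLabelsFrom u f = (c : Fin k) → u ≤ toℕ c → ∃ λ i → f i ≡ c

    NewLabelsInOrder : ℕ → (Fin m → Fin k) → Set
    NewLabelsInOrder u f = (i : Fin m) (c : Fin k) → toℕ c < toℕ (f i) →
      toℕ c < u ⊎ ∃ λ j → toℕ j < toℕ i × f j ≡ c

    Avoids : Table → (Fin m → Fin k) → Set
    Avoids F f = (i : Fin m) → F (toℕ i) (toℕ (f i)) ≡ false

  -- With u labels in use, f labels the remaining vertices so that, together with the labels
  -- already given, the result is a canonical labelling by k stable sets.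
  Completion : (m : ℕ) → Table → ℕ → Table → Pred (Fin m → Fin k) 0ℓ
  Completion m E u F f =
    UsesLabelsFrom u f × NewLabelsInOrder u f × Avoids F f × Stable (undirected m E) f

  allLabelsUsed : ℕ → ℤ
  allLabelsUsed u = if k ≤ᵇ u then 1ℤ else 0ℤ

  -- Counted in ℤ, since the closed forms below need subtraction.
  completions : ℕ → Table → ℕ → Table → ℤ
  completions zero    E u F = allLabelsUsed u
  completions (suc m) E u F = Σ< k λ c →
    if admissible u F c then completions m (shift E) (u ⊔ suc c) (shiftForbidden E F c) else 0ℤ

  private
    admissible⁻ : ∀ {u} F {c} → admissible u F c ≡ true → c ≤ u × F 0 c ≡ false
    admissible⁻ {u} F {c} eq =
      let (c<1+u , allowed) = Equivalence.to T-∧ (Equivalence.from T-≡ eq)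
      in ≤-pred (<ᵇ⇒< c (suc u) c<1+u) , Equivalence.to T-not-≡ allowed

    admissible⁺ : ∀ {u} F {c} → c ≤ u → F 0 c ≡ false → admissible u F c ≡ true
    admissible⁺ {u} F {c} c≤u allowed = Equivalence.to T-≡
      (Equivalence.from (T-∧ {c <ᵇ suc u}) (<⇒<ᵇ (s≤s c≤u) , Equivalence.from T-not-≡ allowed))

  module _ {m : ℕ} {E : Table} {u : ℕ} {F : Table} (f : Fin (suc m) → Fin k) where

    private
      c : ℕ
      c = toℕ (f zero)
      u′ : ℕ
      u′ = u ⊔ suc c

    completion-head : Completion (suc m) E u F f →
      admissible u F c ≡ true × Completion m (shift E) u′ (shiftForbidden E F c) (f ∘ suc)
    completion-head (uses , inOrder , avoids , stable) =
      admissible⁺ F c≤u (avoids zero) , uses′ , inOrder′ , avoids′ , stable′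
      where
      c≤u : c ≤ u
      c≤u with c ≤? u
      ... | yes c≤u = c≤u
      ... | no  c≰u with inOrder zero (fromℕ< (<-trans (≰⇒> c≰u) (toℕ<n (f zero))))
                                     (subst (_< c) (sym (toℕ-fromℕ< _)) (≰⇒> c≰u))
      ...   | inj₁ u<u = ⊥-elim (<-irrefl (toℕ-fromℕ< _) u<u)
      uses′ : UsesLabelsFrom u′ (f ∘ suc)
      uses′ d u′≤d with uses d (≤-trans (m≤m⊔n u (suc c)) u′≤d)
      ... | suc i , fi≡d = i , fi≡d
      ... | zero  , f0≡d = ⊥-elim (<-irrefl (cong toℕ f0≡d)
                                    (<-≤-trans (n<1+n c) (≤-trans (m≤n⊔m u (suc c)) u′≤d)))
      inOrder′ : NewLabelsInOrder u′ (f ∘ suc)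
      inOrder′ i d d<fi with inOrder (suc i) d d<fi
      ... | inj₁ d<u                      = inj₁ (<-≤-trans d<u (m≤m⊔n u (suc c)))
      ... | inj₂ (zero , _ , f0≡d)        =
        inj₁ (subst (_< u′) (cong toℕ f0≡d) (<-≤-trans (n<1+n c) (m≤n⊔m u (suc c))))
      ... | inj₂ (suc j , s≤s j<i , fj≡d) = inj₂ (j , j<i , fj≡d)
      avoids′ : Avoids (shiftForbidden E F c) (f ∘ suc)
      avoids′ i = ∨-∧-false⁺ _ (adjacent E 0 (suc (toℕ i))) _ (avoids (suc i))
        (λ adj → ≢⇒≡ᵇ-false (λ fi≡c → stable zero (suc i) adj (toℕ-injective (sym fi≡c))))
      stable′ : Stable (undirected m (shift E)) (f ∘ suc)
      stable′ i j = stable (suc i) (suc j)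

    completion-cons : Loopless (suc m) E → admissible u F c ≡ true →
      Completion m (shift E) u′ (shiftForbidden E F c) (f ∘ suc) → Completion (suc m) E u F f
    completion-cons loopless adm (uses′ , inOrder′ , avoids′ , stable′) =
      uses , inOrder , avoids , stable
      where
      c≤u : c ≤ u
      c≤u = proj₁ (admissible⁻ F adm)
      avoids-c : ∀ j → adjacent E 0 (suc (toℕ j)) ≡ true → (toℕ (f (suc j)) ≡ᵇ c) ≡ false
      avoids-c j = proj₂ (∨-∧-false⁻ _ (adjacent E 0 (suc (toℕ j))) _ (avoids′ j))
      uses : UsesLabelsFrom u f
      uses d u≤d with f zero ≟ᶠ d
      ... | yes f0≡d = zero , f0≡d
      ... | no  f0≢d
          with uses′ d (⊔-lub u≤d (≤∧≢⇒< (≤-trans c≤u u≤d) (f0≢d ∘ toℕ-injective)))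
      ...   | i , fi≡d = suc i , fi≡d
      inOrder : NewLabelsInOrder u f
      inOrder zero    d d<c = inj₁ (<-≤-trans d<c c≤u)
      inOrder (suc i) d d<fi with inOrder′ i d d<fi
      ... | inj₂ (j , j<i , fj≡d) = inj₂ (suc j , s≤s j<i , fj≡d)
      ... | inj₁ d<u′ with toℕ d <? u
      ...   | yes d<u = inj₁ d<u
      ...   | no  d≮u =
        inj₂ (zero , s≤s z≤n , toℕ-injective (≤-antisym (≤-trans c≤u (≮⇒≥ d≮u)) d≤c))
        where
        d≤c : toℕ d ≤ c
        d≤c with ⊔-sel u (suc c)
        ... | inj₁ u′≡u   = ⊥-elim (d≮u (subst (toℕ d <_) u′≡u d<u′))
        ... | inj₂ u′≡1+c = ≤-pred (subst (toℕ d <_) u′≡1+c d<u′)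
      avoids : Avoids F f
      avoids zero    = proj₂ (admissible⁻ F adm)
      avoids (suc i) = proj₁ (∨-∧-false⁻ _ (adjacent E 0 (suc (toℕ i))) _ (avoids′ i))
      stable : Stable (undirected (suc m) E) f
      stable zero    zero    adj _ with () ← trans (sym adj) (cong (λ x → x ∨ x) (loopless 0 z<s))
      stable (suc i) (suc j) adj       = stable′ i j adj
      stable zero    (suc j) adj f0≡fj = ≡ᵇ-false⇒≢ (avoids-c j adj) (cong toℕ (sym f0≡fj))
      stable (suc i) zero    adj fi≡f0 =
        ≡ᵇ-false⇒≢ (avoids-c i (trans (∨-comm (E 0 (suc (toℕ i))) _) adj)) (cong toℕ fi≡f0)

  completion-empty : ∀ {E u F} (f : Fin 0 → Fin k) → Completion 0 E u F f ⇔ k ≤ u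
  completion-empty {E} {u} {F} f = mk⇔ to from
    where
    to : Completion 0 E u F f → k ≤ u
    to (uses , _) with k ≤? u
    ... | yes k≤u = k≤u
    ... | no  k≰u with uses (fromℕ< (≰⇒> k≰u)) (≤-reflexive (sym (toℕ-fromℕ< _)))
    ...   | () , _
    from : k ≤ u → Completion 0 E u F f
    from k≤u = (λ c u≤c → ⊥-elim (<-irrefl refl (<-≤-trans (toℕ<n c) (≤-trans k≤u u≤c))))
             , (λ ()) , (λ ()) , (λ ())

  length-filter-completions : ∀ m E u F → Loopless m E →
    {P : Pred (Fin m → Fin k) 0ℓ} (P? : Decidable P) → P ≐ Completion m E u F →
    + length (filter P? (allFuns m k)) ≡ completions m E u F
  length-filter-completions zero E u F _ P? (P⊆ , ⊆P) = single _
    where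
    single : (f : Fin 0 → Fin k) → + length (filter P? (f ∷ [])) ≡ completions 0 E u F
    single f with P? f | k ≤ᵇ u in k≤ᵇu
    ... | yes _ | true  = refl
    ... | no  _ | false = refl
    ... | yes p | false = contradiction
      (subst T k≤ᵇu (≤⇒≤ᵇ (Equivalence.to (completion-empty {E} {u} {F} f) (P⊆ p)))) λ ()
    ... | no ¬p | true  = ⊥-elim (¬p (⊆P
      (Equivalence.from (completion-empty {E} {u} {F} f) (≤ᵇ⇒≤ k u (subst T (sym k≤ᵇu) _)))))
  length-filter-completions (suc m) E u F loopless P? (P⊆ , ⊆P) =
    length-filter-concatMap-tabulate P? (λ c → c) _ _ λ c →
      trans (cong +_ (length-filter-map P? _ (allFuns m k))) (labelled c)
    where
    labelled : ∀ c → + length (filter (P? ∘ _) (allFuns m k)) ≡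
      (if admissible u F (toℕ c)
       then completions m (shift E) (u ⊔ suc (toℕ c)) (shiftForbidden E F (toℕ c)) else 0ℤ)
    labelled c with admissible u F (toℕ c) in adm
    ... | true  = length-filter-completions m (shift E) _ _ (λ a a<m → loopless (suc a) (s<s a<m))
                    (P? ∘ _) ( (λ p → proj₂ (completion-head {E = E} {u} {F} _ (P⊆ p)))
                             , (λ q → ⊆P (completion-cons {E = E} {u} {F} _ loopless adm q)) )
    ... | false = cong +_ (length-filter-none (P? ∘ _)
                    (λ g p → contradiction
                      (trans (sym (proj₁ (completion-head {E = E} {u} {F} _ (P⊆ p)))) adm) λ ())
                    (allFuns m k))

  stablePartition≐completion : ∀ {m E} →
    IsStablePartition (undirected m E) ≐ Completion m E 0 nothingForbidden
  stablePartition≐completion =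
      (λ (onto , ordered , stable) →
         (λ c _ → onto c) , (λ i c c<fi → inj₂ (ordered i c c<fi)) , (λ _ → refl) , stable)
    , (λ (uses , inOrder , _ , stable) →
         (λ c → uses c z≤n) , (λ i c c<fi → earlier (inOrder i c c<fi)) , stable)
    where
    earlier : ∀ {A : Set} {c : Fin k} → toℕ c < 0 ⊎ A → A
    earlier (inj₂ x) = x

  S≡completions : ∀ m E → Loopless m E → + S (undirected m E) k ≡ completions m E 0 nothingForbidden
  S≡completions m E loopless =
    length-filter-completions m E 0 nothingForbidden loopless (isStablePartition? (undirected m E))
      (stablePartition≐completion {m} {E})

  completions-suc : ∀ {m E u F} → u ≤ k → F 0 u ≡ false →
    completions (suc m) E u F ≡
      Σ< u (λ d → if F 0 d then 0ℤ else completions m (shift E) u (shiftForbidden E F d)) +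
      (if u <ᵇ k then completions m (shift E) (suc u) (shiftForbidden E F u) else 0ℤ)
  completions-suc {m} {E} {u} {F} u≤k Fu =
    trans (Σ<-split k u (not ∘ F 0) next u≤k) (cong₂ _+_ (Σ<-cong u old) new)
    where
    next : ℕ → ℤ
    next c = completions m (shift E) (u ⊔ suc c) (shiftForbidden E F c)
    old : ∀ d → d < u → (if not (F 0 d) then next d else 0ℤ) ≡
                        (if F 0 d then 0ℤ else completions m (shift E) u (shiftForbidden E F d))
    old d d<u with F 0 d
    ... | true  = refl
    ... | false = cong (λ v → completions m (shift E) v (shiftForbidden E F d)) (m≥n⇒m⊔n≡m d<u)
    new : (if (u <ᵇ k) ∧ not (F 0 u) then next u else 0ℤ) ≡
          (if u <ᵇ k then completions m (shift E) (suc u) (shiftForbidden E F u) else 0ℤ)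
    new rewrite Fu | ∧-identityʳ (u <ᵇ k) | m≤n⇒m⊔n≡n (n≤1+n u) = refl

  completions-forced : ∀ {m E u F X} → u ≤ k →
    (∀ d → d < u → F 0 d ≡ true) → F 0 u ≡ false →
    (u < k → completions m (shift E) (suc u) (shiftForbidden E F u) ≡ X) →
    completions (suc m) E u F ≡ (if u <ᵇ k then X else 0ℤ)
  completions-forced {m} {E} {u} {F} u≤k taken Fu new =
    trans (completions-suc {m} {E} {u} {F} u≤k Fu)
          (trans (cong₂ _+_ (trans (Σ<-cong u none) (Σ<-zero u)) (if<ᵇ-cong new)) (ℤₚ.+-identityˡ _))
    where
    none : ∀ d → d < u →
      (if F 0 d then 0ℤ else completions m (shift E) u (shiftForbidden E F d)) ≡ 0ℤ
    none d d<u rewrite taken d d<u = refl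

  addVertex : ℕ → (ℕ → ℤ) → ℕ → ℤ
  addVertex j h u = (+ u - + j) * h u + (if u <ᵇ k then h (suc u) else 0ℤ)

  completions-addVertex : ∀ {m E u F} (φ : ℕ → Bool) (h : ℕ → ℤ) → u ≤ k →
    (∀ d → F 0 d ≡ φ d) → φ u ≡ false →
    (∀ d → d < u → φ d ≡ false → completions m (shift E) u (shiftForbidden E F d) ≡ h u) →
    (u < k → completions m (shift E) (suc u) (shiftForbidden E F u) ≡ h (suc u)) →
    completions (suc m) E u F ≡ addVertex (countBelow u φ) h u
  completions-addVertex {m} {E} {u} {F} φ h u≤k F≡φ φu old new =
    trans (completions-suc {m} {E} {u} {F} u≤k (trans (F≡φ u) φu))
          (cong₂ _+_ (trans (Σ<-cong u same) (Σ<-avoiding u φ (h u))) (if<ᵇ-cong new))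
    where
    same : ∀ d → d < u → (if F 0 d then 0ℤ else completions m (shift E) u (shiftForbidden E F d)) ≡
                         (if φ d then 0ℤ else h u)
    same d d<u rewrite F≡φ d with φ d in φd
    ... | true  = refl
    ... | false = old d d<u φd

  -- Cliques, paths, and a path followed by a triangle

  cliqueCount : ℕ → ℕ → ℕ → ℤ
  cliqueCount zero    j = allLabelsUsed
  cliqueCount (suc s) j = addVertex j (cliqueCount s (suc j))

  clique-completions : ∀ s {E F} u φ → u ≤ k → IsClique s E →
    (∀ a d → a < s → F a d ≡ φ d) → (∀ d → u ≤ d → φ d ≡ false) →
    completions s E u F ≡ cliqueCount s (countBelow u φ) u
  clique-completions zero    u φ _ _ _ _ = refl
  clique-completions (suc s) {E} {F} u φ u≤k clique forbids fresh =
    completions-addVertex {s} {E} {u} {F} φ (cliqueCount s (suc (countBelow u φ))) u≤k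
      (λ d → forbids 0 d z<s) (fresh u ≤-refl)
      (λ d d<u φd → trans (rest u d ≤-refl u≤k λ e u≤e → >⇒≡ᵇ-false (<-≤-trans d<u u≤e))
                          (cong (λ j → cliqueCount s j u) (countBelow-insert φ d<u φd)))
      (λ u<k → trans (rest (suc u) u (n≤1+n u) u<k (λ e u<e → >⇒≡ᵇ-false u<e))
                     (cong (λ j → cliqueCount s j (suc u))
                           (trans (countBelow-insert φ (n<1+n u) (fresh u ≤-refl))
                                  (cong suc (countBelow-snoc u φ (fresh u ≤-refl))))))
    where
    rest : ∀ v d → u ≤ v → v ≤ k → (∀ e → v ≤ e → (e ≡ᵇ d) ≡ false) →
      completions s (shift E) v (shiftForbidden E F d) ≡
      cliqueCount s (countBelow v (λ e → φ e ∨ (e ≡ᵇ d))) v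
    rest v d u≤v v≤k fresh-d = clique-completions s v _ v≤k
      (λ a b a<b b<s → clique (suc a) (suc b) (s<s a<b) (s<s b<s))
      (λ a e a<s → cong₂ (λ x y → x ∨ (y ∧ (e ≡ᵇ d)))
                         (forbids (suc a) e (s<s a<s)) (clique 0 (suc a) z<s (s<s a<s)))
      (λ e v≤e → cong₂ _∨_ (fresh e (≤-trans u≤v v≤e)) (fresh-d e v≤e))

  addPath : ℕ → (ℕ → ℤ) → ℕ → ℤ
  addPath zero    h = h
  addPath (suc s) h = addVertex 1 (addPath s h)

  path-completions : ∀ s {E F} u l → l < u → u ≤ k → (∀ a b → E a b ≡ path s a b) →
    (∀ a d → a < s → F a d ≡ firstForbids l a d) → completions s E u F ≡ addPath s allLabelsUsed u
  path-completions zero u l _ _ _ _ = refl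
  path-completions (suc s) {E} {F} u l l<u u≤k edges forbids =
    trans (completions-addVertex {s} {E} {u} {F} (_≡ᵇ l) (addPath s allLabelsUsed) u≤k
            (λ d → forbids 0 d z<s) (>⇒≡ᵇ-false l<u)
            (λ d d<u _ → path-completions s u d d<u u≤k edges′ (forbids′ d))
            (λ u<k → path-completions s (suc u) u (n<1+n u) u<k edges′ (forbids′ u)))
          (cong (λ j → addVertex j (addPath s allLabelsUsed) u) (countBelow-single l<u))
    where
    edges′ : ∀ a b → shift E a b ≡ path s a b
    edges′ a b = edges (suc a) (suc b)
    forbids′ : ∀ d a e → a < s → shiftForbidden E F d a e ≡ firstForbids d a e
    forbids′ d a e a<s
      rewrite forbids (suc a) e (s<s a<s) | edges 0 (suc a) | edges (suc a) 0
            | <⇒<ᵇ-true a<s | ∧-identityʳ (a ≡ᵇ 0) | ∨-identityʳ (a ≡ᵇ 0) = refl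

  triangleCount : ℕ → ℤ
  triangleCount = cliqueCount 3 0

  cycleCount : ℕ → Bool → ℕ → ℤ
  cycleCount zero    b       = addVertex (if b then 1 else 2) triangleCount
  cycleCount (suc r) true    = addVertex 1 (cycleCount r false)
  cycleCount (suc r) false u = cycleCount r true u + addVertex 2 (cycleCount r false) u

  cycle-completions : ∀ r {E F} u l → l < u → u ≤ k →
    (∀ a b → E a b ≡ pathThenTriangle r a b) → (∀ a d → F a d ≡ cycleForbidden r l a d) →
    completions (4 ℕ.+ r) E u F ≡ cycleCount r (l ≡ᵇ 0) u
  cycle-completions zero {E} {F} u l l<u u≤k edges forbids =
    trans (completions-addVertex {3} {E} {u} {F} (λ d → (d ≡ᵇ 0) ∨ (d ≡ᵇ l)) triangleCount u≤k
            (λ d → forbids 0 d) fresh (λ d _ _ → triangle u d u≤k) (λ u<k → triangle (suc u) u u<k))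
          (cong (λ j → addVertex j triangleCount u) (countBelow-zero-or l l<u))
    where
    fresh : (u ≡ᵇ 0) ∨ (u ≡ᵇ l) ≡ false
    fresh rewrite >⇒≡ᵇ-false (≤-<-trans z≤n l<u) | >⇒≡ᵇ-false l<u = refl
    triangle : ∀ v d → v ≤ k → completions 3 (shift E) v (shiftForbidden E F d) ≡ triangleCount v
    triangle v d v≤k =
      trans (clique-completions 3 {shift E} {shiftForbidden E F d} v (λ _ → false) v≤k
               (shift-pathThenTriangle-isClique edges) (shiftForbidden-cycleForbidden₀ edges forbids d)
               (λ _ _ → refl))
            (cong (λ j → cliqueCount 3 j v) (countBelow-none v))
  cycle-completions (suc r) {E} {F} u l l<u u≤k edges forbids =
    trans (completions-suc {4 ℕ.+ r} {E} {u} {F} u≤k (trans (forbids 0 u) (>⇒≡ᵇ-false l<u)))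
          (trans (cong₂ _+_ (trans (Σ<-cong u old) (Σ<-except l<u λ b → cycleCount r b u))
                            (if<ᵇ-cong new))
                 (assemble l))
    where
    forbids′ : ∀ d a e → shiftForbidden E F d a e ≡ cycleForbidden r d a e
    forbids′ = shiftForbidden-cycleForbidden {r} {l} edges forbids
    old : ∀ d → d < u →
      (if F 0 d then 0ℤ else completions (4 ℕ.+ r) (shift E) u (shiftForbidden E F d)) ≡
      (if d ≡ᵇ l then 0ℤ else cycleCount r (d ≡ᵇ 0) u)
    old d d<u rewrite forbids 0 d with d ≡ᵇ l
    ... | true  = refl
    ... | false = cycle-completions r u d d<u u≤k (λ a b → edges (suc a) (suc b)) (forbids′ d)
    new : u < k →
      completions (4 ℕ.+ r) (shift E) (suc u) (shiftForbidden E F u) ≡ cycleCount r false (suc u)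
    new u<k
      with cycle-completions r (suc u) u (n<1+n u) u<k (λ a b → edges (suc a) (suc b)) (forbids′ u)
    ... | count rewrite >⇒≡ᵇ-false (≤-<-trans z≤n l<u) = count
    assemble : ∀ l → (if l ≡ᵇ 0 then (+ u - 1ℤ) * cycleCount r false u
                      else cycleCount r true u + (+ u - + 2) * cycleCount r false u)
                     + (if u <ᵇ k then cycleCount r false (suc u) else 0ℤ)
                     ≡ cycleCount (suc r) (l ≡ᵇ 0) u
    assemble zero    = refl
    assemble (suc l) = ℤₚ.+-assoc (cycleCount r true u) _ _

  -- Algebra of the vertex operators

  addVertex-cong : ∀ j {f g : ℕ → ℤ} → f ≗ g → addVertex j f ≗ addVertex j g
  addVertex-cong j f≗g u =
    cong₂ (λ x y → (+ u - + j) * x + (if u <ᵇ k then y else 0ℤ)) (f≗g u) (f≗g (suc u))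

  addVertex-+ : ∀ j f g → addVertex j (λ v → f v + g v) ≗ λ u → addVertex j f u + addVertex j g u
  addVertex-+ j f g u with u <ᵇ k
  ... | true  = distrib (+ u - + j) (f u) (g u) (f (suc u)) (g (suc u))
    where distrib : ∀ a x y x′ y′ → a * (x + y) + (x′ + y′) ≡ (a * x + x′) + (a * y + y′)
          distrib = solve-∀
  ... | false = distrib (+ u - + j) (f u) (g u)
    where distrib : ∀ a x y → a * (x + y) + 0ℤ ≡ (a * x + 0ℤ) + (a * y + 0ℤ)
          distrib = solve-∀

  addVertex-- : ∀ j f g → addVertex j (λ v → f v - g v) ≗ λ u → addVertex j f u - addVertex j g u
  addVertex-- j f g u with u <ᵇ k
  ... | true  = distrib (+ u - + j) (f u) (g u) (f (suc u)) (g (suc u))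
    where distrib : ∀ a x y x′ y′ → a * (x - y) + (x′ - y′) ≡ (a * x + x′) - (a * y + y′)
          distrib = solve-∀
  ... | false = distrib (+ u - + j) (f u) (g u)
    where distrib : ∀ a x y → a * (x - y) + 0ℤ ≡ (a * x + 0ℤ) - (a * y + 0ℤ)
          distrib = solve-∀

  addVertex-* : ∀ j c f → addVertex j (λ v → c * f v) ≗ λ u → c * addVertex j f u
  addVertex-* j c f u with u <ᵇ k
  ... | true  = distrib (+ u - + j) c (f u) (f (suc u))
    where distrib : ∀ a c x x′ → a * (c * x) + c * x′ ≡ c * (a * x + x′)
          distrib = solve-∀
  ... | false = distrib (+ u - + j) c (f u)
    where distrib : ∀ a c x → a * (c * x) + 0ℤ ≡ c * (a * x + 0ℤ)
          distrib = solve-∀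

  addVertex₀ : ∀ h → addVertex 0 h ≗ λ u → addVertex 1 h u + h u
  addVertex₀ h u = shift₁ (+ u) (h u) (if u <ᵇ k then h (suc u) else 0ℤ)
    where shift₁ : ∀ a x y → (a - + 0) * x + y ≡ ((a - + 1) * x + y) + x
          shift₁ = solve-∀

  addVertex₂ : ∀ h → addVertex 2 h ≗ λ u → addVertex 1 h u - h u
  addVertex₂ h u = shift₁ (+ u) (h u) (if u <ᵇ k then h (suc u) else 0ℤ)
    where shift₁ : ∀ a x y → (a - + 2) * x + y ≡ ((a - + 1) * x + y) - x
          shift₁ = solve-∀

  addPath-cong : ∀ s {f g : ℕ → ℤ} → f ≗ g → addPath s f ≗ addPath s g
  addPath-cong zero    f≗g = f≗g
  addPath-cong (suc s) f≗g = addVertex-cong 1 (addPath-cong s f≗g)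

  addPath-addVertex : ∀ s h → addPath s (addVertex 1 h) ≗ addVertex 1 (addPath s h)
  addPath-addVertex zero    h u = refl
  addPath-addVertex (suc s) h   = addVertex-cong 1 (addPath-addVertex s h)

  addPath-- : ∀ s f g → addPath s (λ v → f v - g v) ≗ λ u → addPath s f u - addPath s g u
  addPath-- zero    f g u = refl
  addPath-- (suc s) f g u =
    trans (addVertex-cong 1 (addPath-- s f g) u) (addVertex-- 1 (addPath s f) (addPath s g) u)

  edgeCount : ℕ → ℤ
  edgeCount = cliqueCount 2 1

  sign : ℕ → ℤ
  sign r = -[1+ 0 ] ^ r

  cycleCount-true  : ∀ r → cycleCount r true ≗
    λ u → addPath (2 ℕ.+ r) edgeCount u + sign r * addVertex 1 edgeCount u
  cycleCount-false : ∀ r → cycleCount r false ≗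
    λ u → addPath (2 ℕ.+ r) edgeCount u + sign (suc r) * edgeCount u

  cycleCount-true zero u =
    trans (addVertex-cong 1 (addVertex₀ edgeCount) u)
          (trans (addVertex-+ 1 (addVertex 1 edgeCount) edgeCount u)
                 (one· (addPath 2 edgeCount u) (addVertex 1 edgeCount u)))
    where one· : ∀ x y → x + y ≡ x + 1ℤ * y
          one· = solve-∀
  cycleCount-true (suc r) u =
    trans (addVertex-cong 1 (cycleCount-false r) u)
          (trans (addVertex-+ 1 (addPath (2 ℕ.+ r) edgeCount) (λ v → sign (suc r) * edgeCount v) u)
                 (cong (_+_ (addPath (3 ℕ.+ r) edgeCount u)) (addVertex-* 1 (sign (suc r)) edgeCount u)))

  cycleCount-false zero u =
    trans (addVertex₂ triangleCount u)
          (trans (cong₂ _-_ (trans (addVertex-cong 1 (addVertex₀ edgeCount) u)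
                                   (addVertex-+ 1 (addVertex 1 edgeCount) edgeCount u))
                            (addVertex₀ edgeCount u))
                 (cancel (addPath 2 edgeCount u) (addVertex 1 edgeCount u) (edgeCount u)))
    where cancel : ∀ x y z → (x + y) - (y + z) ≡ x + (-[1+ 0 ] * 1ℤ) * z
          cancel = solve-∀
  cycleCount-false (suc r) u =
    trans (cong₂ _+_ (cycleCount-true r u)
                     (trans (addVertex₂ (cycleCount r false) u)
                            (cong₂ _-_ (cycleCount-true (suc r) u) (cycleCount-false r u))))
          (cancel (addPath (2 ℕ.+ r) edgeCount u) (sign r) (addVertex 1 edgeCount u)
                  (addPath (3 ℕ.+ r) edgeCount u) (edgeCount u))
    where
    cancel : ∀ p s q p′ e →
      (p + s * q) + ((p′ + (-[1+ 0 ] * s) * q) - (p + (-[1+ 0 ] * s) * e)) ≡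
      p′ + (-[1+ 0 ] * (-[1+ 0 ] * s)) * e
    cancel = solve-∀

  addVertex-difference-at-2 : ∀ g →
    addVertex 1 (λ v → addVertex 1 g v - g v) 2 ≡ (if 2 <ᵇ k then addVertex 1 g 3 else 0ℤ)
  addVertex-difference-at-2 g with 2 <ᵇ k
  ... | true  = telescope (g 2) (g 3) (if 3 <ᵇ k then g 4 else 0ℤ)
    where telescope : ∀ x y z → (+ 2 - + 1) * (((+ 2 - + 1) * x + y) - x) + (((+ 3 - + 1) * y + z) - y) ≡
                                (+ 3 - + 1) * y + z
          telescope = solve-∀
  ... | false = telescope (g 2)
    where telescope : ∀ x → (+ 2 - + 1) * (((+ 2 - + 1) * x + 0ℤ) - x) + 0ℤ ≡ 0ℤ
          telescope = solve-∀

  addPath-edgeCount-at-2 : ∀ s →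
    addPath s edgeCount 2 ≡ (if 2 <ᵇ k then addPath (suc s) allLabelsUsed 3 else 0ℤ)
  addPath-edgeCount-at-2 s = begin
    addPath s edgeCount 2
      ≡⟨ addPath-cong s (addVertex-cong 1 (addVertex₂ allLabelsUsed)) 2 ⟩
    addPath s (addVertex 1 (λ v → addVertex 1 allLabelsUsed v - allLabelsUsed v)) 2
      ≡⟨ addPath-addVertex s _ 2 ⟩
    addVertex 1 (addPath s (λ v → addVertex 1 allLabelsUsed v - allLabelsUsed v)) 2
      ≡⟨ addVertex-cong 1 (λ v → trans (addPath-- s _ _ v)
                                        (cong (_- g v) (addPath-addVertex s allLabelsUsed v))) 2 ⟩
    addVertex 1 (λ v → addVertex 1 g v - g v) 2
      ≡⟨ addVertex-difference-at-2 g ⟩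
    (if 2 <ᵇ k then addPath (suc s) allLabelsUsed 3 else 0ℤ) ∎
    where
    open ≡-Reasoning
    g : ℕ → ℤ
    g = addPath s allLabelsUsed

  cycleCount-at-2 : ∀ r → cycleCount r false 2 ≡
    (if 2 <ᵇ k then addPath (3 ℕ.+ r) allLabelsUsed 3 else 0ℤ) - sign r * edgeCount 2
  cycleCount-at-2 r =
    trans (cycleCount-false r 2)
          (trans (cong (_+ sign (suc r) * edgeCount 2) (addPath-edgeCount-at-2 (2 ℕ.+ r)))
                 (negate X (sign r) (edgeCount 2)))
    where
    X : ℤ
    X = if 2 <ᵇ k then addPath (3 ℕ.+ r) allLabelsUsed 3 else 0ℤ
    negate : ∀ x s y → x + (-[1+ 0 ] * s) * y ≡ x - s * y
    negate = solve-∀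

  S-CycleUnionTriangle : ∀ r → + S (CycleUnionTriangle (6 ℕ.+ r)) k ≡
    (if 0 <ᵇ k then (if 1 <ᵇ k then cycleCount r false 2 else 0ℤ) else 0ℤ)
  S-CycleUnionTriangle r =
    trans (S≡completions (6 ℕ.+ r) C (λ a _ → cycleUnionTriangle-loopless r a))
      (completions-forced {5 ℕ.+ r} {C} {0} {nothingForbidden} z≤n (λ _ ()) refl λ 0<k →
       completions-forced {4 ℕ.+ r} {shift C} {1} {F₁} 0<k
         (λ { zero _ → refl ; (suc _) (s≤s ()) }) refl λ 1<k →
       cycle-completions r 2 1 (n<1+n 1) 1<k
         (λ a b → cycleUnionTriangle-tables r (2 ℕ.+ a) (2 ℕ.+ b)) forbids)
    where
    C : Table
    C = cycleUnionTriangleE (6 ℕ.+ r)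
    F₁ : Table
    F₁ = shiftForbidden C nothingForbidden 0
    forbids : ∀ a d → shiftForbidden (shift C) F₁ 1 a d ≡ cycleForbidden r 1 a d
    forbids a d = cong₂ (λ x y → (x ∧ (d ≡ᵇ 0)) ∨ (y ∧ (d ≡ᵇ 1)))
                        (cycleUnionTriangle-adjacent₀ r a) (cycleUnionTriangle-adjacent₁ r a)

  S-Q : ∀ r → + S (Q (6 ℕ.+ r)) k ≡
    (if 0 <ᵇ k then (if 1 <ᵇ k then (if 2 <ᵇ k then addPath (3 ℕ.+ r) allLabelsUsed 3 else 0ℤ)
                                else 0ℤ) else 0ℤ)
  S-Q r =
    trans (S≡completions (6 ℕ.+ r) Qᴱ (λ a _ → Q-loopless r a))
      (completions-forced {5 ℕ.+ r} {Qᴱ} {0} {nothingForbidden} z≤n (λ _ ()) refl λ 0<k →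
       completions-forced {4 ℕ.+ r} {shift Qᴱ} {1} {F₁} 0<k
         (λ { zero _ → refl ; (suc _) (s≤s ()) }) refl λ 1<k →
       completions-forced {3 ℕ.+ r} {shift (shift Qᴱ)} {2} {F₂} 1<k
         (λ { zero _ → refl ; (suc zero) _ → refl ; (suc (suc _)) (s≤s (s≤s ())) }) refl λ 2<k →
       path-completions (3 ℕ.+ r) 3 2 (n<1+n 2) 2<k
         (λ a b → trans (Q-tables r (3 ℕ.+ a) (3 ℕ.+ b)) (∨-identityʳ _)) forbids)
    where
    Qᴱ : Table
    Qᴱ = QE (6 ℕ.+ r)
    F₁ : Table
    F₁ = shiftForbidden Qᴱ nothingForbidden 0
    F₂ : Table
    F₂ = shiftForbidden (shift Qᴱ) F₁ 1
    forbids : ∀ a d → a < 3 ℕ.+ r →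
      shiftForbidden (shift (shift Qᴱ)) F₂ 2 a d ≡ firstForbids 2 a d
    forbids zero    d _ = refl
    forbids (suc a) d _ = refl

edgeCount-at-2 : ∀ k → Counting.edgeCount k 2 ≡ ρ k
edgeCount-at-2 0 = refl
edgeCount-at-2 1 = refl
edgeCount-at-2 2 = refl
edgeCount-at-2 3 = refl
edgeCount-at-2 4 = refl
edgeCount-at-2 (suc (suc (suc (suc (suc k))))) = refl

identity-at-vanishing-counts : ∀ {x y} s → x ≡ 0ℤ → y ≡ 0ℤ → x ≡ y - s * + 0
identity-at-vanishing-counts s refl refl = sym (cong (0ℤ -_) (ℤₚ.*-zeroʳ s))

S-CycleUnionTriangle-Q : ∀ k r →
  + S (CycleUnionTriangle (6 ℕ.+ r)) k ≡ + S (Q (6 ℕ.+ r)) k - (-[1+ 0 ] ^ (6 ℕ.+ r)) * ρ k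
S-CycleUnionTriangle-Q 0 r = identity-at-vanishing-counts (-[1+ 0 ] ^ (6 ℕ.+ r))
  (Counting.S-CycleUnionTriangle 0 r) (Counting.S-Q 0 r)
S-CycleUnionTriangle-Q 1 r = identity-at-vanishing-counts (-[1+ 0 ] ^ (6 ℕ.+ r))
  (Counting.S-CycleUnionTriangle 1 r) (Counting.S-Q 1 r)
S-CycleUnionTriangle-Q k@(suc (suc _)) r = begin
  + S (CycleUnionTriangle (6 ℕ.+ r)) k
    ≡⟨ S-CycleUnionTriangle r ⟩
  cycleCount r false 2
    ≡⟨ cycleCount-at-2 r ⟩
  X - sign r * edgeCount 2
    ≡⟨ cong₂ (λ s e → X - s * e) (sixfold (sign r)) (edgeCount-at-2 k) ⟩
  X - σ * ρ k
    ≡⟨ cong (_- σ * ρ k) (sym (S-Q r)) ⟩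
  + S (Q (6 ℕ.+ r)) k - σ * ρ k ∎
  where
  open ≡-Reasoning
  open Counting k
  X : ℤ
  X = if 2 <ᵇ k then addPath (3 ℕ.+ r) allLabelsUsed 3 else 0ℤ
  σ : ℤ
  σ = -[1+ 0 ] ^ (6 ℕ.+ r)
  sixfold : ∀ s → s ≡ -[1+ 0 ] * (-[1+ 0 ] * (-[1+ 0 ] * (-[1+ 0 ] * (-[1+ 0 ] * (-[1+ 0 ] * s)))))
  sixfold = solve-∀

-- The identity holds for every k.
lemma8 : (n : ℕ) → 6 ≤ n → (k : ℕ) → k ≤ n →
    + S (CycleUnionTriangle n) k ≡ + S (Q n) k - (-[1+ 0 ] ^ n) * ρ k
lemma8 n 6≤n k _ with m≤n⇒∃[o]m+o≡n 6≤n
... | r , 6+r≡n =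
  subst (λ n → + S (CycleUnionTriangle n) k ≡ + S (Q n) k - (-[1+ 0 ] ^ n) * ρ k) 6+r≡n
        (S-CycleUnionTriangle-Q k r)
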